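{- Let $n = 2^{\alpha-1}p^{\beta-1}$, where $\alpha,\beta>1$ are integers and $p$ is an odd prime with $p<3\cdot 2^{\alpha-1}-1$. Then $n$ divides $\sigma_5(n)$ if and only if $n$ is an even perfect number and $n\neq 496$.
   Context: For a positive integer $n$ and integer $k\ge 1$, $\sigma_k(n)=\sum_{d\mid n} d^k$, the sum over positive divisors $d$ of $n$. A positive integer $n$ is perfect if $\sigma_1(n)=2n$. -}

module Defs where

open import Data.Nat using (ℕ; suc; _*_; _^_)
open import Data.Nat.Divisibility using (_∣_; _∣?_)
open import Data.Nat.ListAction using (sum)
open import Data.List using (List; map; filter; upTo)
open import Relation.Binary.PropositionalEquality using (_≡_)

divisors : ℕ → List ℕ
divisors n = filter (_∣? n) (map suc (upTo n))

σ : ℕ → ℕ → ℕ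
σ k n = sum (map (λ d → d ^ k) (divisors n))

Perfect : ℕ → Set
Perfect n = σ 1 n ≡ 2 * n

module Submission where

-- The divisors of n are
-- exactly the 2^i·p^j, so σ_m(n) = geom (2^m) (a+1) · geom (p^m) (b+1)
-- (σ-formula).  For m = 5 write A = geom 32 (a+1) and B = geom (p^5) (b+1):
-- A is odd and B ≡ 1 (mod p), so n ∣ σ_5(n) means 2^a ∣ B and p^b ∣ A.
-- Write p + 1 = 2^k·u with u odd.
-- * k ≤ a: 2 ∣ B makes b + 1 = 2c even, and since 1 + p^5 = (1 + p)·(odd)
--   we get 2^(a−k) ∣ c.  Together with p^b ≤ A < 32^(a+1) and the congruence
--   32^(a−k+1) ≡ u^5 (mod p), only finitely many (a − k, u, k) remain, and an
--   exhaustive computation rules them all out.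
-- * k > a: p + 1 < 3·2^a forces p + 1 = 2^(a+1).  Then 31·A = (1 + p)^5 − 1
--   = p·(5 + p·⋯) shows p² ∤ A, so b = 1, and 31 ∤ A shows p ≠ 31.
-- Euclid's characterisation (2^a·p^b is perfect iff b = 1 and p = 2^(a+1) − 1)
-- and the fact that such a number is 496 iff p = 31 give the equivalence; the
-- converse direction uses p ∣ 31·A and 2^(a+1) ∣ 1 + p^5 = B.

open import Defs
open import Data.Nat
open import Data.Nat.Properties
open import Data.Nat.Divisibility
open import Data.Nat.Primality
open import Data.Nat.Coprimality using (Coprime; coprime-divisor)
open import Data.Nat.DivMod using (m≡m%n+[m/n]*n; m%n<n)
open import Data.Nat.Induction using (<-rec)
open import Data.Nat.ListAction using (sum)
open import Data.Nat.ListAction.Properties using (sum-++; sum-↭)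
open import Data.Nat.Tactic.RingSolver using (solve-∀)
open import Data.List using ([]; _∷_; map; upTo; applyUpTo; cartesianProductWith; _++_)
open import Data.List.Properties using (map-applyUpTo; map-++; map-∘)
open import Data.List.Membership.Propositional using (_∈_)
open import Data.List.Membership.Propositional.Properties
  using (∈-filter⁺; ∈-filter⁻; ∈-map⁺; ∈-upTo⁺; ∈-upTo⁻; ∈-cartesianProductWith⁺; ∈-cartesianProductWith⁻)
open import Data.List.Membership.Propositional.Properties.WithK using (unique∧set⇒bag)
open import Data.List.Relation.Unary.Unique.Propositional using (Unique)
import Data.List.Relation.Unary.Unique.Propositional.Properties as Unique
open import Data.List.Relation.Binary.BagAndSetEquality using (∼bag⇒↭)
open import Data.List.Relation.Binary.Permutation.Propositional using (_↭_)
import Data.List.Relation.Binary.Permutation.Propositional.Properties as Perm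
open import Data.Product using (∃; ∃₂; _×_; _,_; proj₁; proj₂)
open import Data.Sum using (_⊎_; inj₁; inj₂; [_,_]′)
open import Data.Empty using (⊥; ⊥-elim)
open import Data.Unit using (tt)
open import Function using (_∘_; id)
open import Function.Bundles using (_⇔_; mk⇔; Equivalence)
open import Relation.Nullary using (¬_; Dec; yes; no; ¬?; contradiction)
open import Relation.Nullary.Decidable using (_×-dec_; map′; toWitness; toWitnessFalse; from-yes)
open import Relation.Binary.PropositionalEquality
open import Relation.Binary.Definitions using (tri<; tri≈; tri>)

^-distribʳ-* : ∀ x y k → (x * y) ^ k ≡ x ^ k * y ^ k
^-distribʳ-* x y zero    = refl
^-distribʳ-* x y (suc k) = trans (cong (x * y *_) (^-distribʳ-* x y k)) (shuffle x y (x ^ k) (y ^ k))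
  where
  shuffle : ∀ x y X Y → x * y * (X * Y) ≡ x * X * (y * Y)
  shuffle = solve-∀

^-swap : ∀ m i k → (m ^ i) ^ k ≡ (m ^ k) ^ i
^-swap m i k = trans (^-*-assoc m i k) (trans (cong (m ^_) (*-comm i k)) (sym (^-*-assoc m k i)))

^-cancelʳ-< : ∀ m {x y} → 1 < m → m ^ x < m ^ y → x < y
^-cancelʳ-< m {x} {y} 1<m mx<my with x <? y
... | yes x<y = x<y
... | no x≮y  = contradiction (^-monoʳ-≤ m {{>-nonZero (<-trans z<s 1<m)}} (≮⇒≥ x≮y)) (<⇒≱ mx<my)

^-injective : ∀ m {x y} → 1 < m → m ^ x ≡ m ^ y → x ≡ y
^-injective m {x} {y} 1<m e with <-cmp x y
... | tri< x<y _ _ = contradiction e (<⇒≢ (^-monoʳ-< m 1<m x<y))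
... | tri≈ _ x≡y _ = x≡y
... | tri> _ _ y<x = contradiction (sym e) (<⇒≢ (^-monoʳ-< m 1<m y<x))

^-monoʳ-∣ : ∀ m {i j} → i ≤ j → m ^ i ∣ m ^ j
^-monoʳ-∣ m {j = j} z≤n     = 1∣ (m ^ j)
^-monoʳ-∣ m         (s≤s i≤j) = *-monoʳ-∣ m (^-monoʳ-∣ m i≤j)

odd⇒1+2t : ∀ {n} → ¬ 2 ∣ n → ∃ λ t → n ≡ 1 + 2 * t
odd⇒1+2t {n} n-odd = n / 2 , (begin
  n                 ≡⟨ m≡m%n+[m/n]*n n 2 ⟩
  n % 2 + n / 2 * 2 ≡⟨ cong₂ _+_ remainder (*-comm (n / 2) 2) ⟩
  1 + 2 * (n / 2)   ∎)
  where
  open ≡-Reasoning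
  remainder : n % 2 ≡ 1
  remainder with n % 2 | m%n<n n 2 | m%n≡0⇒n∣m n 2
  ... | 0           | _            | 2∣n = ⊥-elim (n-odd (2∣n refl))
  ... | 1           | _            | _   = refl
  ... | suc (suc _) | s≤s (s≤s ()) | _

1+2t-odd : ∀ t → ¬ 2 ∣ 1 + 2 * t
1+2t-odd t 2∣ = contradiction (∣1⇒≡1 (∣m+n∣m⇒∣n (subst (2 ∣_) (+-comm 1 (2 * t)) 2∣) (m∣m*n t))) λ ()

odd⇒≡1⊎≥3 : ∀ {u} → ¬ 2 ∣ u → u ≡ 1 ⊎ 3 ≤ u
odd⇒≡1⊎≥3 {0}                 u-odd = ⊥-elim (u-odd (divides 0 refl))
odd⇒≡1⊎≥3 {1}                 _     = inj₁ refl
odd⇒≡1⊎≥3 {2}                 u-odd = ⊥-elim (u-odd (divides 1 refl))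
odd⇒≡1⊎≥3 {suc (suc (suc u))} _     = inj₂ (s≤s (s≤s (s≤s z≤n)))

odd-^ : ∀ {p} j → ¬ 2 ∣ p → ¬ 2 ∣ p ^ j
odd-^     zero    _     2∣1   = contradiction (∣1⇒≡1 2∣1) λ ()
odd-^ {p} (suc j) p-odd 2∣p^j with euclidsLemma p (p ^ j) prime[2] 2∣p^j
... | inj₁ 2∣p = p-odd 2∣p
... | inj₂ 2∣q = odd-^ j p-odd 2∣q

odd-* : ∀ {x y} → ¬ 2 ∣ x → ¬ 2 ∣ y → ¬ 2 ∣ x * y
odd-* {x} {y} x-odd y-odd 2∣xy with euclidsLemma x y prime[2] 2∣xy
... | inj₁ 2∣x = x-odd 2∣x
... | inj₂ 2∣y = y-odd 2∣y

odd-square : ∀ {q} → ¬ 2 ∣ q → ∃ λ T → q * q ≡ 1 + 4 * T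
odd-square q-odd with odd⇒1+2t q-odd
... | t , refl = t + t * t , expand t
  where
  expand : ∀ t → (1 + 2 * t) * (1 + 2 * t) ≡ 1 + 4 * (t + t * t)
  expand = solve-∀

odd-part : ∀ n → n ≢ 0 → ∃₂ λ k u → n ≡ 2 ^ k * u × ¬ 2 ∣ u
odd-part = <-rec _ split
  where
  split : ∀ n → (∀ {m} → m < n → m ≢ 0 → ∃₂ λ k u → m ≡ 2 ^ k * u × ¬ 2 ∣ u) →
          n ≢ 0 → ∃₂ λ k u → n ≡ 2 ^ k * u × ¬ 2 ∣ u
  split n rec n≢0 with 2 ∣? n
  ... | no n-odd = 0 , n , sym (*-identityˡ n) , n-odd
  ... | yes (divides m refl) with rec (m<m*n m 2 {{≢-nonZero m≢0}} ≤-refl) m≢0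
    where
    m≢0 : m ≢ 0
    m≢0 refl = n≢0 refl
  ...   | k , u , refl , u-odd = suc k , u , swap (2 ^ k) u , u-odd
    where
    swap : ∀ x u → x * u * 2 ≡ 2 * x * u
    swap = solve-∀

odd-part-unique : ∀ {i i' u u'} → ¬ 2 ∣ u → ¬ 2 ∣ u' → 2 ^ i * u ≡ 2 ^ i' * u' → i ≡ i' × u ≡ u'
odd-part-unique {zero}  {zero}  {u} {u'} _ _ e = refl , trans (sym (*-identityˡ u)) (trans e (*-identityˡ u'))
odd-part-unique {suc i} {suc i'} {u} {u'} u-odd u'-odd e
  with odd-part-unique {i} {i'} u-odd u'-odd
         (*-cancelˡ-≡ _ _ 2 (trans (sym (*-assoc 2 (2 ^ i) u)) (trans e (*-assoc 2 (2 ^ i') u'))))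
... | refl , refl = refl , refl
odd-part-unique {zero} {suc i'} {u} {u'} u-odd _ e =
  ⊥-elim (u-odd (subst (2 ∣_) (trans (sym e) (*-identityˡ u)) (∣m⇒∣m*n u' (m∣m*n (2 ^ i')))))
odd-part-unique {suc i} {zero} {u} {u'} _ u'-odd e =
  ⊥-elim (u'-odd (subst (2 ∣_) (trans e (*-identityˡ u')) (∣m⇒∣m*n u (m∣m*n (2 ^ i)))))

prime-power-cancel : ∀ {q x y} e → Prime q → ¬ q ∣ y → q ^ e ∣ x * y → q ^ e ∣ x
prime-power-cancel {q} {x}     zero    _       _    _ = 1∣ x
prime-power-cancel {q} {x} {y} (suc e) q-prime q∤y qe∣xy
  with euclidsLemma x y q-prime (∣-trans (m∣m*n (q ^ e)) qe∣xy)
... | inj₂ q∣y = contradiction q∣y q∤y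
... | inj₁ (divides x' refl) = subst (q * q ^ e ∣_) (*-comm q x') (*-monoʳ-∣ q (prime-power-cancel e q-prime q∤y qe∣x'y))
  where
  regroup : ∀ x q y → x * q * y ≡ q * (x * y)
  regroup = solve-∀
  qe∣x'y : q ^ e ∣ x' * y
  qe∣x'y = *-cancelˡ-∣ q {{prime⇒nonZero q-prime}} (subst (q * q ^ e ∣_) (regroup x' q y) qe∣xy)

prime-split : ∀ {q x m} → Prime q → x ∣ q * m → (∃ λ y → x ≡ q * y × y ∣ m) ⊎ x ∣ m
prime-split {q} {x} {m} q-prime x∣qm with q ∣? x
... | yes (divides y refl) = inj₁ (y , *-comm y q ,
        *-cancelˡ-∣ q {{prime⇒nonZero q-prime}} (subst (_∣ q * m) (*-comm y q) x∣qm))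
... | no q∤x = inj₂ (coprime-divisor x⊥q x∣qm)
  where
  x⊥q : Coprime x q
  x⊥q (i∣x , i∣q) with prime⇒irreducible q-prime i∣q
  ... | inj₁ i≡1 = i≡1
  ... | inj₂ refl = contradiction i∣x q∤x

prime-power-divisor : ∀ {p x} b → Prime p → x ∣ p ^ b → ∃ λ j → j ≤ b × x ≡ p ^ j
prime-power-divisor zero    _       x∣1 = 0 , z≤n , ∣1⇒≡1 x∣1
prime-power-divisor (suc b) p-prime x∣ with prime-split p-prime x∣
... | inj₁ (y , refl , y∣) with prime-power-divisor b p-prime y∣
...   | j , j≤b , refl = suc j , s≤s j≤b , refl
prime-power-divisor (suc b) p-prime x∣ | inj₂ x∣' with prime-power-divisor b p-prime x∣'
... | j , j≤b , x≡ = j , m≤n⇒m≤1+n j≤b , x≡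

complementary-divisors : ∀ {x y m n} .{{_ : NonZero (m * n)}} → x * y ≡ m * n → n ∣ x → m ∣ y → x ≡ n × y ≡ m
complementary-divisors {x} {y} {m} {n} xy≡mn (divides s refl) (divides t refl) =
  trans (cong (_* n) s≡1) (*-identityˡ n) , trans (cong (_* m) t≡1) (*-identityˡ m)
  where
  regroup : ∀ s t m n → s * n * (t * m) ≡ s * t * (m * n)
  regroup = solve-∀
  st≡1 : s * t ≡ 1
  st≡1 = *-cancelʳ-≡ (s * t) 1 (m * n) (trans (sym (regroup s t m n)) (trans xy≡mn (sym (*-identityˡ (m * n)))))
  s≡1 : s ≡ 1
  s≡1 = m*n≡1⇒m≡1 s t st≡1
  t≡1 : t ≡ 1
  t≡1 = m*n≡1⇒n≡1 s t st≡1

congruence⇒∣gap : ∀ {p x y z w} → x ≤ z → x + p * y ≡ z + p * w → p ∣ ∣ x - z ∣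
congruence⇒∣gap {p} {x} {y} {z} {w} x≤z e = subst (p ∣_) (sym (m≤n⇒∣m-n∣≡n∸m x≤z))
  (∣m+n∣m⇒∣n (subst (p ∣_) (+-comm (z ∸ x) (p * w)) (subst (p ∣_) (sym gap) (m∣m*n y))) (m∣m*n w))
  where
  gap : z ∸ x + p * w ≡ p * y
  gap = +-cancelˡ-≡ x _ _ (begin
    x + (z ∸ x + p * w) ≡⟨ sym (+-assoc x (z ∸ x) (p * w)) ⟩
    x + (z ∸ x) + p * w ≡⟨ cong (_+ p * w) (m+[n∸m]≡n x≤z) ⟩
    z + p * w           ≡⟨ sym e ⟩
    x + p * y           ∎)
    where open ≡-Reasoning

congruence⇒∣distance : ∀ {p} x y z w → x + p * y ≡ z + p * w → p ∣ ∣ x - z ∣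
congruence⇒∣distance {p} x y z w e with ≤-total x z
... | inj₁ x≤z = congruence⇒∣gap x≤z e
... | inj₂ z≤x = subst (p ∣_) (∣-∣-comm z x) (congruence⇒∣gap z≤x (sym e))

prime[5] : Prime 5
prime[5] = from-yes (prime? 5)

prime[31] : Prime 31
prime[31] = from-yes (prime? 31)

6≢2^ : ∀ a → 6 ≢ 2 ^ suc a
6≢2^ zero    ()
6≢2^ (suc a) e = toWitnessFalse {a? = 2 ∣? 3} tt (divides (2 ^ a) (trans (*-cancelˡ-≡ 3 _ 2 e) (*-comm 2 (2 ^ a))))

geom : ℕ → ℕ → ℕ
geom r zero    = 0
geom r (suc n) = 1 + r * geom r n

-- (r − 1)·geom r n = r^n − 1, written for r = 1 + s to stay inside ℕ.
geom-closed : ∀ s n → s * geom (suc s) n + 1 ≡ suc s ^ n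
geom-closed s zero    = cong (_+ 1) (*-zeroʳ s)
geom-closed s (suc n) = begin
  s * (1 + suc s * G) + 1 ≡⟨ expand s G ⟩
  suc s * (s * G + 1)     ≡⟨ cong (suc s *_) (geom-closed s n) ⟩
  suc s * suc s ^ n       ∎
  where
  open ≡-Reasoning
  G = geom (suc s) n
  expand : ∀ s G → s * (1 + (1 + s) * G) + 1 ≡ (1 + s) * (s * G + 1)
  expand = solve-∀

geom-base-2 : ∀ a → geom 2 a + 1 ≡ 2 ^ a
geom-base-2 a = trans (cong (_+ 1) (sym (*-identityˡ (geom 2 a)))) (geom-closed 1 a)

-- If 1 + p + ⋯ + p^b collapses to its last term plus 1, then p = p^b:
-- multiply by p − 1 and compare with p^(b+1) − 1.
geom-two-terms : ∀ {p} b .{{_ : NonZero p}} → geom p (suc b) ≡ p ^ b + 1 → p ≡ p ^ b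
geom-two-terms {suc s} b S≡ = trans (+-comm 1 s) (+-cancelˡ-≡ (s * P) _ _ (begin
  s * P + (s + 1)         ≡⟨ expand s P ⟩
  s * (P + 1) + 1         ≡⟨ cong (λ x → s * x + 1) (sym S≡) ⟩
  s * geom (suc s) (suc b) + 1 ≡⟨ geom-closed s (suc b) ⟩
  suc s * P               ≡⟨ split s P ⟩
  s * P + P               ∎))
  where
  open ≡-Reasoning
  P = suc s ^ b
  expand : ∀ s X → s * X + (s + 1) ≡ s * (X + 1) + 1
  expand = solve-∀
  split : ∀ s X → (1 + s) * X ≡ s * X + X
  split = solve-∀

geom-pair : ∀ r → geom r 2 ≡ 1 + r
geom-pair = expand
  where
  expand : ∀ r → 1 + r * (1 + r * 0) ≡ 1 + r
  expand = solve-∀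

sum-geometric : ∀ (f : ℕ → ℕ) x r n → (∀ i → f i ≡ x * r ^ i) → sum (map f (upTo n)) ≡ x * geom r n
sum-geometric f x r n f≗ = trans (cong sum (map-applyUpTo id f n)) (from-head f x n f≗)
  where
  from-head : ∀ (f : ℕ → ℕ) x n → (∀ i → f i ≡ x * r ^ i) → sum (applyUpTo f n) ≡ x * geom r n
  from-head f x zero    _  = sym (*-zeroʳ x)
  from-head f x (suc n) f≗ = begin
    f 0 + sum (applyUpTo (f ∘ suc) n) ≡⟨ cong₂ _+_ (f≗ 0) (from-head (f ∘ suc) (x * r) n shifted) ⟩
    x * 1 + x * r * geom r n          ≡⟨ factor x r (geom r n) ⟩
    x * (1 + r * geom r n)            ∎
    where
    open ≡-Reasoning
    shifted : ∀ i → f (suc i) ≡ x * r * r ^ i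
    shifted i = trans (f≗ (suc i)) (sym (*-assoc x r (r ^ i)))
    factor : ∀ x r G → x * 1 + x * r * G ≡ x * (1 + r * G)
    factor = solve-∀

geom-even : ∀ q c → geom q (c * 2) ≡ (1 + q) * geom (q * q) c
geom-even q zero    = sym (*-zeroʳ (1 + q))
geom-even q (suc c) = begin
  1 + q * (1 + q * geom q (c * 2))             ≡⟨ cong (λ G → 1 + q * (1 + q * G)) (geom-even q c) ⟩
  1 + q * (1 + q * ((1 + q) * geom (q * q) c)) ≡⟨ regroup q (geom (q * q) c) ⟩
  (1 + q) * (1 + q * q * geom (q * q) c)       ∎
  where
  open ≡-Reasoning
  regroup : ∀ q G → 1 + q * (1 + q * ((1 + q) * G)) ≡ (1 + q) * (1 + q * q * G)
  regroup = solve-∀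

-- geom r (n + 1) ≡ 1 (mod r): no divisor q > 1 of r divides it.
geom-coprime : ∀ {q r} n → 1 < q → q ∣ r → ¬ q ∣ geom r (suc n)
geom-coprime {q} {r} n 1<q q∣r q∣geom =
  <⇒≱ 1<q (∣⇒≤ (∣m+n∣m⇒∣n (subst (q ∣_) (+-comm 1 _) q∣geom) (∣m⇒∣m*n (geom r n) q∣r)))

geom-parity : ∀ {r} n → ¬ 2 ∣ r → 2 ∣ geom r n → 2 ∣ n
geom-parity {r} n r-odd 2∣geom with odd⇒1+2t r-odd
... | t , refl with geom≡n+even n
  where
  geom≡n+even : ∀ n → ∃ λ e → geom (1 + 2 * t) n ≡ n + 2 * e
  geom≡n+even zero    = 0 , refl
  geom≡n+even (suc n) with geom≡n+even n
  ... | e , eq = t * n + (1 + 2 * t) * e , trans (cong (λ G → 1 + (1 + 2 * t) * G) eq) (expand t n e)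
    where
    expand : ∀ t n e → 1 + (1 + 2 * t) * (n + 2 * e) ≡ suc n + 2 * (t * n + (1 + 2 * t) * e)
    expand = solve-∀
...   | e , eq = ∣m+n∣m⇒∣n (subst (2 ∣_) (trans eq (+-comm n (2 * e))) 2∣geom) (m∣m*n e)

geom-2-adic : ∀ j {r c} → (∃ λ t → r ≡ 1 + 4 * t) → 2 ^ j ∣ geom r c → 2 ^ j ∣ c
geom-2-adic zero    {c = c} _ _ = 1∣ c
geom-2-adic (suc j) {c = c} (t , refl) 2^j+1∣geom
  with geom-parity c r-odd (∣-trans (m∣m*n (2 ^ j)) 2^j+1∣geom)
  where
  r-odd : ¬ 2 ∣ 1 + 4 * t
  r-odd = subst (λ x → ¬ 2 ∣ x) (cong suc (twice t)) (1+2t-odd (2 * t))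
    where
    twice : ∀ t → 2 * (2 * t) ≡ 4 * t
    twice = solve-∀
... | divides c' refl = subst (2 * 2 ^ j ∣_) (*-comm 2 c') (*-monoʳ-∣ 2 2^j∣c')
  where
  r = 1 + 4 * t
  C = geom (r * r) c'
  pair : ∀ t C → (1 + (1 + 4 * t)) * C ≡ 2 * (C * (1 + 2 * t))
  pair = solve-∀
  2^j∣C : 2 ^ j ∣ C
  2^j∣C = prime-power-cancel j prime[2] (1+2t-odd t)
            (*-cancelˡ-∣ 2 (subst (2 * 2 ^ j ∣_) (trans (geom-even r c') (pair t C)) 2^j+1∣geom))
  square : ∀ t → (1 + 4 * t) * (1 + 4 * t) ≡ 1 + 4 * (2 * t + 4 * (t * t))
  square = solve-∀
  2^j∣c' : 2 ^ j ∣ c'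
  2^j∣c' = geom-2-adic j (2 * t + 4 * (t * t) , square t) 2^j∣C

divisor-shape : ∀ {p x} a b → Prime p → x ∣ 2 ^ a * p ^ b → ∃₂ λ i j → i ≤ a × j ≤ b × x ≡ 2 ^ i * p ^ j
divisor-shape {p} {x} zero b p-prime x∣
  with prime-power-divisor b p-prime (subst (x ∣_) (*-identityˡ (p ^ b)) x∣)
... | j , j≤b , refl = 0 , j , z≤n , j≤b , sym (*-identityˡ (p ^ j))
divisor-shape {p} {x} (suc a) b p-prime x∣
  with prime-split prime[2] (subst (x ∣_) (*-assoc 2 (2 ^ a) (p ^ b)) x∣)
... | inj₁ (y , refl , y∣) with divisor-shape a b p-prime y∣
...   | i , j , i≤a , j≤b , refl = suc i , j , s≤s i≤a , j≤b , sym (*-assoc 2 (2 ^ i) (p ^ j))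
divisor-shape {p} {x} (suc a) b p-prime x∣ | inj₂ x∣' with divisor-shape a b p-prime x∣'
... | i , j , i≤a , j≤b , x≡ = i , j , m≤n⇒m≤1+n i≤a , j≤b , x≡

2^i*p^j-injective : ∀ {p} → Prime p → ¬ 2 ∣ p → ∀ {i i' j j'} → 2 ^ i * p ^ j ≡ 2 ^ i' * p ^ j' → i ≡ i' × j ≡ j'
2^i*p^j-injective {p} p-prime p-odd {j = j} {j'} e with odd-part-unique (odd-^ j p-odd) (odd-^ j' p-odd) e
... | i≡i' , pj≡pj' = i≡i' , ^-injective p (nonTrivial⇒n>1 p {{prime⇒nonTrivial p-prime}}) pj≡pj'

sum-cartesianProduct : ∀ (F : ℕ → ℕ) (h : ℕ → ℕ → ℕ) xs ys →
  sum (map F (cartesianProductWith h xs ys)) ≡ sum (map (λ x → sum (map (λ y → F (h x y)) ys)) xs)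
sum-cartesianProduct F h []       ys = refl
sum-cartesianProduct F h (x ∷ xs) ys = begin
  sum (map F (map (h x) ys ++ cartesianProductWith h xs ys))
    ≡⟨ cong sum (map-++ F (map (h x) ys) _) ⟩
  sum (map F (map (h x) ys) ++ map F (cartesianProductWith h xs ys))
    ≡⟨ sum-++ (map F (map (h x) ys)) _ ⟩
  sum (map F (map (h x) ys)) + sum (map F (cartesianProductWith h xs ys))
    ≡⟨ cong₂ _+_ (cong sum (sym (map-∘ ys))) (sum-cartesianProduct F h xs ys) ⟩
  sum (map (λ y → F (h x y)) ys) + sum (map (λ x → sum (map (λ y → F (h x y)) ys)) xs) ∎
  where open ≡-Reasoning

divisors-2^a*p^b : ∀ a b {p} → Prime p → ¬ 2 ∣ p →
  divisors (2 ^ a * p ^ b) ↭ cartesianProductWith (λ i j → 2 ^ i * p ^ j) (upTo (suc a)) (upTo (suc b))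
divisors-2^a*p^b a b {p} p-prime p-odd = ∼bag⇒↭ (unique∧set⇒bag divisors-unique products-unique (mk⇔ to from))
  where
  N = 2 ^ a * p ^ b
  h : ℕ → ℕ → ℕ
  h i j = 2 ^ i * p ^ j
  L = cartesianProductWith h (upTo (suc a)) (upTo (suc b))
  instance
    N≢0 : NonZero N
    N≢0 = m*n≢0 (2 ^ a) (p ^ b) {{m^n≢0 2 a}} {{m^n≢0 p b {{prime⇒nonZero p-prime}}}}
  divisors-unique : Unique (divisors N)
  divisors-unique = Unique.filter⁺ (_∣? N) (Unique.map⁺ suc-injective (Unique.upTo⁺ N))
  products-unique : Unique L
  products-unique = Unique.cartesianProductWith⁺ h (2^i*p^j-injective p-prime p-odd) (Unique.upTo⁺ (suc a)) (Unique.upTo⁺ (suc b))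
  to : ∀ {x} → x ∈ divisors N → x ∈ L
  to x∈ with ∈-filter⁻ (_∣? N) {xs = map suc (upTo N)} x∈
  ... | _ , x∣N with divisor-shape a b p-prime x∣N
  ...   | i , j , i≤a , j≤b , refl = ∈-cartesianProductWith⁺ h (∈-upTo⁺ (s≤s i≤a)) (∈-upTo⁺ (s≤s j≤b))
  from : ∀ {x} → x ∈ L → x ∈ divisors N
  from x∈ with ∈-cartesianProductWith⁻ h (upTo (suc a)) (upTo (suc b)) x∈
  ... | i , j , i∈ , j∈ , refl = ∈-filter⁺ (_∣? N) (in-range (h i j) hij∣N) hij∣N
    where
    hij∣N : h i j ∣ N
    hij∣N = *-pres-∣ (^-monoʳ-∣ 2 (≤-pred (∈-upTo⁻ i∈))) (^-monoʳ-∣ p (≤-pred (∈-upTo⁻ j∈)))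
    in-range : ∀ d → d ∣ N → d ∈ map suc (upTo N)
    in-range zero    0∣N = contradiction (0∣⇒≡0 0∣N) (≢-nonZero⁻¹ N)
    in-range (suc d) d∣N = ∈-map⁺ suc (∈-upTo⁺ (∣⇒≤ d∣N))

σ-formula : ∀ k a b {p} → Prime p → ¬ 2 ∣ p →
  σ k (2 ^ a * p ^ b) ≡ geom (2 ^ k) (suc a) * geom (p ^ k) (suc b)
σ-formula k a b {p} p-prime p-odd = begin
  σ k (2 ^ a * p ^ b)
    ≡⟨ sum-↭ (Perm.map⁺ (_^ k) (divisors-2^a*p^b a b p-prime p-odd)) ⟩
  sum (map (_^ k) (cartesianProductWith h (upTo (suc a)) (upTo (suc b))))
    ≡⟨ sum-cartesianProduct (_^ k) h (upTo (suc a)) (upTo (suc b)) ⟩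
  sum (map (λ i → sum (map (λ j → h i j ^ k) (upTo (suc b)))) (upTo (suc a)))
    ≡⟨ sum-geometric _ B (2 ^ k) (suc a) row ⟩
  B * geom (2 ^ k) (suc a)
    ≡⟨ *-comm B _ ⟩
  geom (2 ^ k) (suc a) * B ∎
  where
  open ≡-Reasoning
  h : ℕ → ℕ → ℕ
  h i j = 2 ^ i * p ^ j
  B = geom (p ^ k) (suc b)
  term : ∀ i j → h i j ^ k ≡ (2 ^ k) ^ i * (p ^ k) ^ j
  term i j = trans (^-distribʳ-* (2 ^ i) (p ^ j) k) (cong₂ _*_ (^-swap 2 i k) (^-swap p j k))
  row : ∀ i → sum (map (λ j → h i j ^ k) (upTo (suc b))) ≡ B * (2 ^ k) ^ i
  row i = trans (sum-geometric _ ((2 ^ k) ^ i) (p ^ k) (suc b) (term i)) (*-comm _ B)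

-- ((1 + p)^5 − 1)/p.
quintic : ℕ → ℕ
quintic p = 5 + p * (10 + p * (10 + p * (5 + p)))

binomial-5 : ∀ p → suc p ^ 5 ≡ 1 + p * quintic p
binomial-5 = expand
  where
  expand : ∀ p → (1 + p) * ((1 + p) * ((1 + p) * ((1 + p) * ((1 + p) * 1)))) ≡ 1 + p * (5 + p * (10 + p * (10 + p * (5 + p))))
  expand = solve-∀

31A+1 : ∀ n → 31 * geom 32 n + 1 ≡ 32 ^ n
31A+1 = geom-closed 31

-- For odd p, 1 + p^5 = (1 + p)·W with W = 1 − p + p² − p³ + p⁴ odd.
1+p^5-factor : ∀ {p} → ¬ 2 ∣ p → ∃ λ W → 1 + p ^ 5 ≡ (1 + p) * W × ¬ 2 ∣ W
1+p^5-factor p-odd with odd⇒1+2t p-odd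
... | t , refl = 1 + 2 * V t , expand t , 1+2t-odd (V t)
  where
  V : ℕ → ℕ
  V t = t * (1 + 2 * t) * ((1 + 2 * t) * (1 + 2 * t) + 1)
  expand : ∀ t → 1 + (1 + 2 * t) * ((1 + 2 * t) * ((1 + 2 * t) * ((1 + 2 * t) * ((1 + 2 * t) * 1))))
                 ≡ (1 + (1 + 2 * t)) * (1 + 2 * (t * (1 + 2 * t) * ((1 + 2 * t) * (1 + 2 * t) + 1)))
  expand = solve-∀

-- n ∣ σ_5(n) = A·B splits into the condition 2^a ∣ B at 2 and p^b ∣ A at p,
-- where A = geom 32 (a+1) is odd and B = geom (p^5) (b+1) is 1 modulo p.
σ5-divisibility-split : ∀ a b {p} → Prime p → ¬ 2 ∣ p → 2 ^ a * p ^ b ∣ σ 5 (2 ^ a * p ^ b) →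
  2 ^ a ∣ geom (p ^ 5) (suc b) × p ^ b ∣ geom 32 (suc a)
σ5-divisibility-split a b {p} p-prime p-odd n∣σ = 2^a∣B , p^b∣A
  where
  A = geom 32 (suc a)
  B = geom (p ^ 5) (suc b)
  n∣AB : 2 ^ a * p ^ b ∣ A * B
  n∣AB = subst (2 ^ a * p ^ b ∣_) (σ-formula 5 a b p-prime p-odd) n∣σ
  2^a∣B : 2 ^ a ∣ B
  2^a∣B = prime-power-cancel a prime[2] (geom-coprime a ≤-refl (divides 16 refl))
            (subst (2 ^ a ∣_) (*-comm A B) (∣-trans (m∣m*n (p ^ b)) n∣AB))
  p^b∣A : p ^ b ∣ A
  p^b∣A = prime-power-cancel b p-prime (geom-coprime b (nonTrivial⇒n>1 p {{prime⇒nonTrivial p-prime}}) (m∣m*n (p ^ 4)))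
            (∣-trans (n∣m*n (2 ^ a)) n∣AB)

mersenne-31A : ∀ {a p} → suc p ≡ 2 ^ suc a → 31 * geom 32 (suc a) ≡ p * quintic p
mersenne-31A {a} {p} p+1≡ = +-cancelʳ-≡ 1 _ _ (begin
  31 * geom 32 (suc a) + 1 ≡⟨ 31A+1 (suc a) ⟩
  32 ^ suc a               ≡⟨ sym (^-swap 2 (suc a) 5) ⟩
  (2 ^ suc a) ^ 5          ≡⟨ cong (_^ 5) (sym p+1≡) ⟩
  suc p ^ 5                ≡⟨ binomial-5 p ⟩
  1 + p * quintic p        ≡⟨ +-comm 1 _ ⟩
  p * quintic p + 1        ∎)
  where open ≡-Reasoning

-- For a Mersenne prime p: p^b ∣ A forces b = 1 (since p² ∣ 31·A = p·quintic p
-- would give p ∣ 5), and p ≠ 31 (as 31 ∤ 1 + 32 + ⋯ + 32⁴).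
mersenne-valuation : ∀ {a b p} → 1 ≤ b → Prime p → suc p ≡ 2 ^ suc a →
  p ^ b ∣ geom 32 (suc a) → b ≡ 1 × p ≢ 31
mersenne-valuation {a} {b} {p} 1≤b p-prime p+1≡ p^b∣A = b≡1 b 1≤b p^b∣A , p≢31
  where
  instance
    p≢0 : NonZero p
    p≢0 = prime⇒nonZero p-prime
  p∣A : p ∣ geom 32 (suc a)
  p∣A = ∣-trans (subst (_∣ p ^ b) (*-identityʳ p) (^-monoʳ-∣ p 1≤b)) p^b∣A
  p∤5 : ¬ p ∣ 5
  p∤5 p∣5 with prime⇒irreducible prime[5] p∣5
  ... | inj₁ p≡1 = <⇒≢ (nonTrivial⇒n>1 p {{prime⇒nonTrivial p-prime}}) (sym p≡1)
  ... | inj₂ p≡5 = 6≢2^ a (trans (cong suc (sym p≡5)) p+1≡)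
  p²∤A : ¬ p * p ∣ geom 32 (suc a)
  p²∤A p²∣A = p∤5 (∣m+n∣m⇒∣n (subst (p ∣_) (+-comm 5 _) (*-cancelˡ-∣ p p²∣p*quintic)) (m∣m*n _))
    where
    p²∣p*quintic : p * p ∣ p * quintic p
    p²∣p*quintic = subst (p * p ∣_) (mersenne-31A {a} p+1≡) (∣n⇒∣m*n 31 p²∣A)
  b≡1 : ∀ b → 1 ≤ b → p ^ b ∣ geom 32 (suc a) → b ≡ 1
  b≡1 1              _ _        = refl
  b≡1 (suc (suc b')) _ p^b'+2∣A = ⊥-elim (p²∤A p²∣A)
    where
    p²∣A : p * p ∣ geom 32 (suc a)
    p²∣A = ∣-trans (subst (_∣ p ^ suc (suc b')) (cong (p *_) (*-identityʳ p)) (^-monoʳ-∣ p {2} {suc (suc b')} (s≤s (s≤s z≤n)))) p^b'+2∣A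
  p≢31 : p ≢ 31
  p≢31 p≡31 with ^-injective 2 {5} {suc a} ≤-refl (trans (cong suc (sym p≡31)) p+1≡)
  ... | refl = toWitnessFalse {a? = 31 ∣? geom 32 5} tt (subst (_∣ geom 32 5) p≡31 p∣A)

mersenne-496 : ∀ {a p} → ¬ 2 ∣ p → suc p ≡ 2 ^ suc a → (2 ^ a * p ^ 1 ≡ 496) ⇔ (p ≡ 31)
mersenne-496 {a} {p} p-odd p+1≡ = mk⇔ to from
  where
  to : 2 ^ a * p ^ 1 ≡ 496 → p ≡ 31
  to e = trans (sym (*-identityʳ p)) (proj₂ (odd-part-unique {a} {4} (odd-^ 1 p-odd) (toWitnessFalse {a? = 2 ∣? 31} tt) e))
  from : p ≡ 31 → 2 ^ a * p ^ 1 ≡ 496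
  from refl with ^-injective 2 {5} {suc a} ≤-refl p+1≡
  ... | refl = refl

mersenne⇒perfect : ∀ {a p} → Prime p → ¬ 2 ∣ p → suc p ≡ 2 ^ suc a → Perfect (2 ^ a * p ^ 1)
mersenne⇒perfect {a} {p} p-prime p-odd p+1≡ = begin
  σ 1 (2 ^ a * p ^ 1)              ≡⟨ σ-formula 1 a 1 p-prime p-odd ⟩
  geom 2 (suc a) * geom (p ^ 1) 2  ≡⟨ cong₂ _*_ geom≡p (geom-pair (p ^ 1)) ⟩
  p * (1 + p ^ 1)                  ≡⟨ *-comm p (1 + p ^ 1) ⟩
  (1 + p ^ 1) * p                  ≡⟨ cong (λ x → (1 + x) * p) (*-identityʳ p) ⟩
  suc p * p                        ≡⟨ cong₂ _*_ p+1≡ (sym (*-identityʳ p)) ⟩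
  2 * 2 ^ a * p ^ 1                ≡⟨ *-assoc 2 (2 ^ a) (p ^ 1) ⟩
  2 * (2 ^ a * p ^ 1)              ∎
  where
  open ≡-Reasoning
  geom≡p : geom 2 (suc a) ≡ p
  geom≡p = suc-injective (trans (+-comm 1 _) (trans (geom-base-2 (suc a)) (sym p+1≡)))

-- Conversely, 2^a·p^b with b ≥ 1 is perfect only in Euclid's case:
-- (2^(a+1) − 1)·(1 + p + ⋯ + p^b) = 2^(a+1)·p^b forces the two factors to be
-- p^b and 2^(a+1), and 1 + p + ⋯ + p^b = p^b + 1 forces b = 1.
perfect⇒mersenne : ∀ {a b p} → Prime p → ¬ 2 ∣ p → Perfect (2 ^ a * p ^ b) → b ≡ 1 × suc p ≡ 2 ^ suc a
perfect⇒mersenne {a} {b} {p} p-prime p-odd perfect = b≡1 , p+1≡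
  where
  instance
    p≢0 : NonZero p
    p≢0 = prime⇒nonZero p-prime
    M*p^b≢0 : NonZero (2 ^ suc a * p ^ b)
    M*p^b≢0 = m*n≢0 (2 ^ suc a) (p ^ b) {{m^n≢0 2 (suc a)}} {{m^n≢0 p b}}
  1<p : 1 < p
  1<p = nonTrivial⇒n>1 p {{prime⇒nonTrivial p-prime}}
  G = geom 2 (suc a)
  S = geom p (suc b)
  GS≡ : G * S ≡ 2 ^ suc a * p ^ b
  GS≡ = begin
    G * S                   ≡⟨ cong (λ r → G * geom r (suc b)) (sym (*-identityʳ p)) ⟩
    G * geom (p ^ 1) (suc b) ≡⟨ sym (σ-formula 1 a b p-prime p-odd) ⟩
    σ 1 (2 ^ a * p ^ b)     ≡⟨ perfect ⟩
    2 * (2 ^ a * p ^ b)     ≡⟨ sym (*-assoc 2 (2 ^ a) (p ^ b)) ⟩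
    2 ^ suc a * p ^ b       ∎
    where open ≡-Reasoning
  p^b∣G : p ^ b ∣ G
  p^b∣G = prime-power-cancel b p-prime (geom-coprime b 1<p ∣-refl) (subst (p ^ b ∣_) (sym GS≡) (n∣m*n (2 ^ suc a)))
  M∣S : 2 ^ suc a ∣ S
  M∣S = prime-power-cancel (suc a) prime[2] (geom-coprime a ≤-refl ∣-refl)
          (subst (2 ^ suc a ∣_) (trans (sym GS≡) (*-comm G S)) (m∣m*n (p ^ b)))
  G≡ : G ≡ p ^ b
  G≡ = proj₁ (complementary-divisors GS≡ p^b∣G M∣S)
  S≡ : S ≡ p ^ b + 1
  S≡ = trans (proj₂ (complementary-divisors GS≡ p^b∣G M∣S)) (trans (sym (geom-base-2 (suc a))) (cong (_+ 1) G≡))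
  p≡p^b : p ≡ p ^ b
  p≡p^b = geom-two-terms b S≡
  b≡1 : b ≡ 1
  b≡1 = sym (^-injective p 1<p (trans (*-identityʳ p) p≡p^b))
  p+1≡ : suc p ≡ 2 ^ suc a
  p+1≡ = trans (+-comm 1 p) (trans (cong (_+ 1) (trans p≡p^b (sym G≡))) (geom-base-2 (suc a)))

-- For Mersenne p ≠ 31: p ∣ 31·A and p ∤ 31 give p ∣ A, while
-- B = 1 + p^5 = (1 + p)·W = 2^(a+1)·W; hence 2^a·p ∣ A·B = σ_5(2^a·p).
mersenne⇒σ5-divisible : ∀ {a p} → Prime p → ¬ 2 ∣ p → suc p ≡ 2 ^ suc a → p ≢ 31 →
  2 ^ a * p ^ 1 ∣ σ 5 (2 ^ a * p ^ 1)
mersenne⇒σ5-divisible {a} {p} p-prime p-odd p+1≡ p≢31 =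
  subst (2 ^ a * p ^ 1 ∣_) (trans (*-comm B A) (sym (σ-formula 5 a 1 p-prime p-odd))) (*-pres-∣ 2^a∣B p^1∣A)
  where
  A = geom 32 (suc a)
  B = geom (p ^ 5) 2
  p∤31 : ¬ p ∣ 31
  p∤31 p∣31 with prime⇒irreducible prime[31] p∣31
  ... | inj₁ p≡1 = <⇒≢ (nonTrivial⇒n>1 p {{prime⇒nonTrivial p-prime}}) (sym p≡1)
  ... | inj₂ p≡31 = p≢31 p≡31
  p∣31A : p ∣ 31 * A
  p∣31A = divides (quintic p) (trans (mersenne-31A {a} p+1≡) (*-comm p (quintic p)))
  p^1∣A : p ^ 1 ∣ A
  p^1∣A = subst (_∣ A) (sym (*-identityʳ p)) ([ (λ p∣31 → contradiction p∣31 p∤31) , id ]′ (euclidsLemma 31 A p-prime p∣31A))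
  2^a∣B : 2 ^ a ∣ B
  2^a∣B with 1+p^5-factor p-odd
  ... | W , 1+p^5≡ , _ = divides (2 * W) (begin
    B                 ≡⟨ geom-pair (p ^ 5) ⟩
    1 + p ^ 5         ≡⟨ 1+p^5≡ ⟩
    suc p * W         ≡⟨ cong (_* W) p+1≡ ⟩
    2 * 2 ^ a * W     ≡⟨ regroup (2 ^ a) W ⟩
    2 * W * 2 ^ a     ∎)
    where
    open ≡-Reasoning
    regroup : ∀ x W → 2 * x * W ≡ 2 * W * x
    regroup = solve-∀

excess-divides : ∀ {a b c k u p} → ¬ 2 ∣ p → ¬ 2 ∣ u → k ≤ a → suc p ≡ 2 ^ k * u → suc b ≡ c * 2 →
  2 ^ a ∣ geom (p ^ 5) (suc b) → 2 ^ (a ∸ k) ∣ c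
excess-divides {a} {b} {c} {k} {u} {p} p-odd u-odd k≤a p+1≡ b+1≡ 2^a∣B with 1+p^5-factor p-odd
... | W , 1+p^5≡ , W-odd = geom-2-adic (a ∸ k) (odd-square (odd-^ 5 p-odd)) 2^[a-k]∣C
  where
  q = p ^ 5
  C = geom (q * q) c
  B≡ : geom q (suc b) ≡ 2 ^ k * (C * (u * W))
  B≡ = begin
    geom q (suc b)    ≡⟨ cong (geom q) b+1≡ ⟩
    geom q (c * 2)    ≡⟨ geom-even q c ⟩
    (1 + q) * C       ≡⟨ cong (_* C) 1+p^5≡ ⟩
    (1 + p) * W * C   ≡⟨ cong (λ x → x * W * C) p+1≡ ⟩
    2 ^ k * u * W * C ≡⟨ regroup (2 ^ k) u W C ⟩
    2 ^ k * (C * (u * W)) ∎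
    where
    open ≡-Reasoning
    regroup : ∀ K u W C → K * u * W * C ≡ K * (C * (u * W))
    regroup = solve-∀
  2^a≡ : 2 ^ a ≡ 2 ^ k * 2 ^ (a ∸ k)
  2^a≡ = trans (cong (2 ^_) (sym (m+[n∸m]≡n k≤a))) (^-distribˡ-+-* 2 k (a ∸ k))
  2^[a-k]∣C : 2 ^ (a ∸ k) ∣ C
  2^[a-k]∣C = prime-power-cancel (a ∸ k) prime[2] (odd-* u-odd W-odd)
                (*-cancelˡ-∣ (2 ^ k) {{m^n≢0 2 k}} (subst₂ _∣_ 2^a≡ B≡ 2^a∣B))

odd-part-bound : ∀ {a k u p} → k ≤ a → suc p ≡ 2 ^ k * u → suc p < 3 * 2 ^ a → u < 3 * 2 ^ (a ∸ k)
odd-part-bound {a} {k} {u} {p} k≤a p+1≡ p+1< = *-cancelˡ-< (2 ^ k) u (3 * 2 ^ (a ∸ k)) (begin-strict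
  2 ^ k * u                ≡⟨ sym p+1≡ ⟩
  suc p                    <⟨ p+1< ⟩
  3 * 2 ^ a                ≡⟨ cong (3 *_) (trans (cong (2 ^_) (sym (m+[n∸m]≡n k≤a))) (^-distribˡ-+-* 2 k (a ∸ k))) ⟩
  3 * (2 ^ k * 2 ^ (a ∸ k)) ≡⟨ regroup (2 ^ k) (2 ^ (a ∸ k)) ⟩
  2 ^ k * (3 * 2 ^ (a ∸ k)) ∎)
  where
  open ≤-Reasoning
  regroup : ∀ K G → 3 * (K * G) ≡ K * (3 * G)
  regroup = solve-∀

-- Modulo p, the small case gives 32^(e+1) ≡ u^5: multiply 31·A + 1 = 32^k·32^(e+1)
-- by u^5 and use 32^k·u^5 = (1 + p)^5 ≡ 1.
fifth-power-congruence : ∀ {k e u p} → suc p ≡ 2 ^ k * u → p ∣ geom 32 (suc (k + e)) →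
  p ∣ ∣ u ^ 5 - 32 ^ suc e ∣
fifth-power-congruence {k} {e} {u} {p} p+1≡ (divides A' A≡) =
  congruence⇒∣distance (u ^ 5) (U * 31 * A') (32 ^ suc e) (quintic p * 32 ^ suc e) (begin
    U + p * (U * 31 * A')           ≡⟨ pull U p A' ⟩
    U * (31 * (A' * p) + 1)         ≡⟨ cong (λ A → U * (31 * A + 1)) (sym A≡) ⟩
    U * (31 * A + 1)                ≡⟨ cong (U *_) (31A+1 (suc (k + e))) ⟩
    U * 32 ^ suc (k + e)            ≡⟨ cong (λ x → U * 32 ^ x) (sym (+-suc k e)) ⟩
    U * 32 ^ (k + suc e)            ≡⟨ cong (U *_) (^-distribˡ-+-* 32 k (suc e)) ⟩
    U * (32 ^ k * G)                ≡⟨ swap U (32 ^ k) G ⟩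
    (32 ^ k * U) * G                ≡⟨ cong (_* G) (sym 32^k*U≡) ⟩
    suc p ^ 5 * G                   ≡⟨ cong (_* G) (binomial-5 p) ⟩
    (1 + p * quintic p) * G         ≡⟨ push p (quintic p) G ⟩
    G + p * (quintic p * G)         ∎)
  where
  open ≡-Reasoning
  A = geom 32 (suc (k + e))
  U = u ^ 5
  G = 32 ^ suc e
  32^k*U≡ : suc p ^ 5 ≡ 32 ^ k * U
  32^k*U≡ = trans (cong (_^ 5) p+1≡) (trans (^-distribʳ-* (2 ^ k) u 5) (cong (_* U) (^-swap 2 k 5)))
  pull : ∀ U p A' → U + p * (U * 31 * A') ≡ U * (31 * (A' * p) + 1)
  pull = solve-∀
  swap : ∀ U K G → U * (K * G) ≡ (K * U) * G
  swap = solve-∀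
  push : ∀ p E G → (1 + p * E) * G ≡ G + p * (E * G)
  push = solve-∀

-- Size: p^b ≤ A < 32^(k+e+1) ≤ 32·p^5·32^(e+1) ≤ p^(5(e+3)), using 2^k ≤ p + 1 ≤ 2p.
valuation-bound : ∀ {k e u b p} → Prime p → suc p ≡ 2 ^ k * u → p ^ b ∣ geom 32 (suc (k + e)) →
  b < 5 * (3 + e)
valuation-bound {k} {e} {u} {b} {p} p-prime p+1≡ p^b∣A = ^-cancelʳ-< p 1<p (begin-strict
  p ^ b                          ≤⟨ ∣⇒≤ p^b∣A ⟩
  A                              <⟨ s≤s (m≤n*m A 31) ⟩
  suc (31 * A)                   ≡⟨ trans (+-comm 1 (31 * A)) (31A+1 (suc (k + e))) ⟩
  32 ^ suc (k + e)               ≡⟨ cong (32 ^_) (sym (+-suc k e)) ⟩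
  32 ^ (k + suc e)               ≡⟨ ^-distribˡ-+-* 32 k (suc e) ⟩
  32 ^ k * 32 ^ suc e            ≤⟨ *-monoˡ-≤ (32 ^ suc e) 32^k≤ ⟩
  32 * p ^ 5 * 32 ^ suc e        ≡⟨ regroup (p ^ 5) (32 ^ suc e) ⟩
  p ^ 5 * (2 ^ 5) ^ (2 + e)      ≡⟨ cong (p ^ 5 *_) (^-*-assoc 2 5 (2 + e)) ⟩
  p ^ 5 * 2 ^ (5 * (2 + e))      ≤⟨ *-monoʳ-≤ (p ^ 5) (^-monoˡ-≤ (5 * (2 + e)) 1<p) ⟩
  p ^ 5 * p ^ (5 * (2 + e))      ≡⟨ sym (^-distribˡ-+-* p 5 (5 * (2 + e))) ⟩
  p ^ (5 + 5 * (2 + e))          ≡⟨ cong (p ^_) (sym (*-suc 5 (2 + e))) ⟩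
  p ^ (5 * (3 + e))              ∎)
  where
  open ≤-Reasoning
  A = geom 32 (suc (k + e))
  1<p : 1 < p
  1<p = nonTrivial⇒n>1 p {{prime⇒nonTrivial p-prime}}
  u≢0 : NonZero u
  u≢0 = ≢-nonZero λ { refl → contradiction (trans p+1≡ (*-zeroʳ (2 ^ k))) λ () }
  32^k≤ : 32 ^ k ≤ 32 * p ^ 5
  32^k≤ = begin
    32 ^ k        ≡⟨ sym (^-swap 2 k 5) ⟩
    (2 ^ k) ^ 5   ≤⟨ ^-monoˡ-≤ 5 (≤-trans (m≤m*n (2 ^ k) u {{u≢0}}) (≤-reflexive (sym p+1≡))) ⟩
    suc p ^ 5     ≤⟨ ^-monoˡ-≤ 5 (+-monoˡ-≤ p (<⇒≤ 1<p)) ⟩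
    (p + p) ^ 5   ≡⟨ cong (λ x → (p + x) ^ 5) (sym (+-identityʳ p)) ⟩
    (2 * p) ^ 5   ≡⟨ ^-distribʳ-* 2 p 5 ⟩
    32 * p ^ 5    ∎
  regroup : ∀ P G → 32 * P * G ≡ P * (32 * G)
  regroup = solve-∀

exponential-bound : ∀ e → 2 ^ suc e ≤ 5 * (3 + e) → e < 5
exponential-bound e 2^e+1≤ with e <? 5
... | yes e<5 = e<5
... | no e≮5 = contradiction 2^e+1≤ (<⇒≱ (subst (λ e → 5 * (3 + e) < 2 ^ suc e) (m+[n∸m]≡n (≮⇒≥ e≮5)) (grows (e ∸ 5))))
  where
  grows : ∀ x → 5 * (3 + (5 + x)) < 2 ^ suc (5 + x)
  grows zero    = <ᵇ⇒< 40 64 tt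
  grows (suc x) = begin-strict
    5 * (3 + (5 + suc x))      ≡⟨ step x ⟩
    5 * (3 + (5 + x)) + 5      <⟨ +-monoˡ-< 5 {5 * (3 + (5 + x))} {2 ^ suc (5 + x)} (grows x) ⟩
    2 ^ suc (5 + x) + 5        ≤⟨ +-monoʳ-≤ (2 ^ suc (5 + x)) (≤-trans (m≤m*n 5 (3 + (5 + x))) (<⇒≤ (grows x))) ⟩
    2 ^ suc (5 + x) + 2 ^ suc (5 + x) ≡⟨ double (2 ^ suc (5 + x)) ⟩
    2 ^ suc (5 + suc x)        ∎
    where
    open ≤-Reasoning
    step : ∀ x → 5 * (3 + (5 + suc x)) ≡ 5 * (3 + (5 + x)) + 5
    step = solve-∀
    double : ∀ y → y + y ≡ 2 * y
    double = solve-∀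

-- The configurations the small case leaves, with e = a − k and p = 2^k·u − 1.
SmallCaseWitness : ℕ → ℕ → ℕ → Set
SmallCaseWitness e u k =
  ¬ 2 ∣ u × 1 < p × p ∣ ∣ u ^ 5 - 32 ^ suc e ∣ × p ^ (2 ^ suc e ∸ 1) ∣ geom 32 (suc (k + e))
  where p = 2 ^ k * u ∸ 1

-- Decided with the primitive distance ∣_-_∣′ for efficiency.
small-case-witness? : ∀ e u k → Dec (SmallCaseWitness e u k)
small-case-witness? e u k =
  ¬? (2 ∣? u) ×-dec 1 <? p ×-dec distance? ×-dec p ^ (2 ^ suc e ∸ 1) ∣? geom 32 (suc (k + e))
  where
  p = 2 ^ k * u ∸ 1
  distance? : Dec (p ∣ ∣ u ^ 5 - 32 ^ suc e ∣)
  distance? = map′ (subst (p ∣_) (sym (∣-∣≡∣-∣′ (u ^ 5) (32 ^ suc e))))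
                   (subst (p ∣_) (∣-∣≡∣-∣′ (u ^ 5) (32 ^ suc e)))
                   (p ∣? ∣ u ^ 5 - 32 ^ suc e ∣′)

no-small-case-witness : ∀ {e} → e < 5 → ∀ {u} → u < 3 * 2 ^ e → ∀ {k} → k < 28 → ¬ SmallCaseWitness e u k
no-small-case-witness = toWitness
  {a? = allUpTo? (λ e → allUpTo? (λ u → allUpTo? (λ k → ¬? (small-case-witness? e u k)) 28) (3 * 2 ^ e)) 5} tt

-- For odd u the distance ∣u^5 − 32^(e+1)∣ between an odd and an even number is
-- nonzero, and for e < 5, u < 3·2^e it is at most 47^5 + 32^5.
fifth-power-distance : ∀ {e u} → ¬ 2 ∣ u → e < 5 → u < 3 * 2 ^ e →
  ∣ u ^ 5 - 32 ^ suc e ∣ ≢ 0 × ∣ u ^ 5 - 32 ^ suc e ∣ ≤ 47 ^ 5 + 32 ^ 5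
fifth-power-distance {e} {u} u-odd e<5 u< = D≢0 , D≤
  where
  D≢0 : ∣ u ^ 5 - 32 ^ suc e ∣ ≢ 0
  D≢0 D≡0 = odd-^ 5 u-odd (subst (2 ∣_) (sym (∣m-n∣≡0⇒m≡n D≡0)) (∣m⇒∣m*n (32 ^ e) (divides 16 refl)))
  u≤47 : u ≤ 47
  u≤47 = ≤-pred (≤-trans u< (*-monoʳ-≤ 3 (^-monoʳ-≤ 2 {e} {4} (≤-pred e<5))))
  D≤ : ∣ u ^ 5 - 32 ^ suc e ∣ ≤ 47 ^ 5 + 32 ^ 5
  D≤ = begin
    ∣ u ^ 5 - 32 ^ suc e ∣ ≤⟨ ∣m-n∣≤m⊔n (u ^ 5) (32 ^ suc e) ⟩
    u ^ 5 ⊔ 32 ^ suc e     ≤⟨ m⊔n≤m+n (u ^ 5) (32 ^ suc e) ⟩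
    u ^ 5 + 32 ^ suc e     ≤⟨ +-mono-≤ {u ^ 5} {47 ^ 5} {32 ^ suc e} {32 ^ 5} (^-monoˡ-≤ 5 u≤47) (^-monoʳ-≤ 32 e<5) ⟩
    47 ^ 5 + 32 ^ 5        ∎
    where open ≤-Reasoning

-- The small case p + 1 = 2^k·u, u < 3·2^e, b + 1 ≥ 2^(e+1), p^b ∣ A (with
-- a = k + e) is impossible: the bounds above confine it to the search range.
small-case-impossible : ∀ {k e u b p} → Prime p → ¬ 2 ∣ u → suc p ≡ 2 ^ k * u → u < 3 * 2 ^ e →
  2 ^ suc e ≤ suc b → p ^ b ∣ geom 32 (suc (k + e)) → ⊥
small-case-impossible {k} {e} {u} {b} {p} p-prime u-odd p+1≡ u< 2^e+1≤b+1 p^b∣A =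
  no-small-case-witness e<5 u< k<28 (u-odd , subst (1 <_) p≡ 1<p , subst (_∣ D) p≡ p∣D ,
    subst (λ q → q ^ (2 ^ suc e ∸ 1) ∣ A) p≡ (∣-trans (^-monoʳ-∣ p (∸-monoˡ-≤ 1 2^e+1≤b+1)) p^b∣A))
  where
  A = geom 32 (suc (k + e))
  D = ∣ u ^ 5 - 32 ^ suc e ∣
  1<p : 1 < p
  1<p = nonTrivial⇒n>1 p {{prime⇒nonTrivial p-prime}}
  p≡ : p ≡ 2 ^ k * u ∸ 1
  p≡ = cong (_∸ 1) p+1≡
  1≤b : 1 ≤ b
  1≤b = ≤-pred (≤-trans (^-monoʳ-≤ 2 {1} {suc e} (s≤s z≤n)) 2^e+1≤b+1)
  p∣D : p ∣ D
  p∣D = fifth-power-congruence {k} {e} {u} p+1≡ (∣-trans (subst (_∣ p ^ b) (*-identityʳ p) (^-monoʳ-∣ p 1≤b)) p^b∣A)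
  e<5 : e < 5
  e<5 = exponential-bound e (≤-trans 2^e+1≤b+1 (valuation-bound {k} {e} {u} p-prime p+1≡ p^b∣A))
  D-bounds : D ≢ 0 × D ≤ 47 ^ 5 + 32 ^ 5
  D-bounds = fifth-power-distance u-odd e<5 u<
  k<28 : k < 28
  k<28 = ^-cancelʳ-< 2 ≤-refl (begin-strict
    2 ^ k                 ≤⟨ m≤m*n (2 ^ k) u {{≢-nonZero λ { refl → u-odd (divides 0 refl) }}} ⟩
    2 ^ k * u             ≡⟨ sym p+1≡ ⟩
    suc p                 ≤⟨ s≤s (≤-trans (∣⇒≤ {{≢-nonZero (proj₁ D-bounds)}} p∣D) (proj₂ D-bounds)) ⟩
    suc (47 ^ 5 + 32 ^ 5) <⟨ <ᵇ⇒< (suc (47 ^ 5 + 32 ^ 5)) (2 ^ 28) tt ⟩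
    2 ^ 28                ∎)
    where open ≤-Reasoning

-- If k > a then p + 1 < 3·2^a ≤ 2^k·3 leaves only u = 1, k = a + 1.
large-case : ∀ {a k u p} → ¬ 2 ∣ u → a < k → suc p ≡ 2 ^ k * u → suc p < 3 * 2 ^ a → suc p ≡ 2 ^ suc a
large-case {a} {k} {u} {p} u-odd a<k p+1≡ p+1< with odd⇒≡1⊎≥3 u-odd
... | inj₂ 3≤u = contradiction p+1< (≤⇒≯ (begin
  3 * 2 ^ a       ≤⟨ m≤m+n (3 * 2 ^ a) (3 * 2 ^ a) ⟩
  3 * 2 ^ a + 3 * 2 ^ a ≡⟨ double (2 ^ a) ⟩
  2 ^ suc a * 3   ≤⟨ *-mono-≤ (^-monoʳ-≤ 2 a<k) 3≤u ⟩
  2 ^ k * u       ≡⟨ sym p+1≡ ⟩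
  suc p           ∎))
  where
  open ≤-Reasoning
  double : ∀ x → 3 * x + 3 * x ≡ 2 * x * 3
  double = solve-∀
... | inj₁ refl = trans p+1≡' (cong (2 ^_) (≤-antisym (≤-pred k<a+2) a<k))
  where
  p+1≡' : suc p ≡ 2 ^ k
  p+1≡' = trans p+1≡ (*-identityʳ (2 ^ k))
  k<a+2 : k < suc (suc a)
  k<a+2 = ^-cancelʳ-< 2 ≤-refl (begin-strict
    2 ^ k             ≡⟨ sym p+1≡' ⟩
    suc p             <⟨ p+1< ⟩
    3 * 2 ^ a         ≤⟨ *-monoˡ-≤ (2 ^ a) (n≤1+n 3) ⟩
    4 * 2 ^ a         ≡⟨ quadruple (2 ^ a) ⟩
    2 ^ suc (suc a)   ∎)
    where
    open ≤-Reasoning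
    quadruple : ∀ x → 4 * x ≡ 2 * (2 * x)
    quadruple = solve-∀

-- Under p + 1 < 3·2^a, the two conditions of σ5-divisibility-split force
-- p + 1 = 2^(a+1): write b + 1 = 2c and p + 1 = 2^k·u, and compare k with a.
σ5-divisible⇒mersenne : ∀ {a b p} → 1 ≤ a → Prime p → ¬ 2 ∣ p → suc p < 3 * 2 ^ a →
  2 ^ a ∣ geom (p ^ 5) (suc b) → p ^ b ∣ geom 32 (suc a) → suc p ≡ 2 ^ suc a
σ5-divisible⇒mersenne {a} {b} {p} 1≤a p-prime p-odd p+1< 2^a∣B p^b∣A
  with geom-parity (suc b) (odd-^ 5 p-odd) (∣-trans (^-monoʳ-∣ 2 1≤a) 2^a∣B) | odd-part (suc p) (λ ())
... | divides c b+1≡ | k , u , p+1≡ , u-odd with k ≤? a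
...   | no k≰a = large-case u-odd (≰⇒> k≰a) p+1≡ p+1<
...   | yes k≤a = ⊥-elim (small-case-impossible {k} {a ∸ k} p-prime u-odd p+1≡
                    (odd-part-bound k≤a p+1≡ p+1<) 2^[a-k+1]≤b+1 p^b∣A')
  where
  c≢0 : NonZero c
  c≢0 = ≢-nonZero λ { refl → contradiction b+1≡ λ () }
  2^[a-k+1]≤b+1 : 2 ^ suc (a ∸ k) ≤ suc b
  2^[a-k+1]≤b+1 = begin
    2 * 2 ^ (a ∸ k) ≡⟨ *-comm 2 (2 ^ (a ∸ k)) ⟩
    2 ^ (a ∸ k) * 2 ≤⟨ *-monoˡ-≤ 2 (∣⇒≤ {{c≢0}} (excess-divides p-odd u-odd k≤a p+1≡ b+1≡ 2^a∣B)) ⟩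
    c * 2           ≡⟨ sym b+1≡ ⟩
    suc b           ∎
    where open ≤-Reasoning
  p^b∣A' : p ^ b ∣ geom 32 (suc (k + (a ∸ k)))
  p^b∣A' = subst (λ x → p ^ b ∣ geom 32 (suc x)) (sym (m+[n∸m]≡n k≤a)) p^b∣A

mersenne⇒even-perfect-≢496 : ∀ {a b p} → 1 ≤ a → Prime p → ¬ 2 ∣ p → suc p ≡ 2 ^ suc a → b ≡ 1 × p ≢ 31 →
  (2 ∣ 2 ^ a * p ^ b × Perfect (2 ^ a * p ^ b)) × 2 ^ a * p ^ b ≢ 496
mersenne⇒even-perfect-≢496 {a} 1≤a p-prime p-odd p+1≡ (refl , p≢31) =
  (∣-trans (^-monoʳ-∣ 2 1≤a) (m∣m*n _) , mersenne⇒perfect {a} p-prime p-odd p+1≡) ,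
  p≢31 ∘ Equivalence.to (mersenne-496 {a} p-odd p+1≡)

mersenne-≢496⇒σ5-divisible : ∀ {a b p} → Prime p → ¬ 2 ∣ p → b ≡ 1 × suc p ≡ 2 ^ suc a →
  2 ^ a * p ^ b ≢ 496 → 2 ^ a * p ^ b ∣ σ 5 (2 ^ a * p ^ b)
mersenne-≢496⇒σ5-divisible {a} p-prime p-odd (refl , p+1≡) n≢496 =
  mersenne⇒σ5-divisible {a} p-prime p-odd p+1≡ (n≢496 ∘ Equivalence.from (mersenne-496 {a} p-odd p+1≡))

forward : ∀ {a b p} → 1 ≤ a → 1 ≤ b → Prime p → ¬ 2 ∣ p → suc p < 3 * 2 ^ a →
  2 ^ a * p ^ b ∣ σ 5 (2 ^ a * p ^ b) →
  (2 ∣ 2 ^ a * p ^ b × Perfect (2 ^ a * p ^ b)) × 2 ^ a * p ^ b ≢ 496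
forward {a} {b} {p} 1≤a 1≤b p-prime p-odd p+1< n∣σ5 =
  mersenne⇒even-perfect-≢496 {a} {b} 1≤a p-prime p-odd p+1≡ (mersenne-valuation {a} {b} 1≤b p-prime p+1≡ p^b∣A)
  where
  2^a∣B : 2 ^ a ∣ geom (p ^ 5) (suc b)
  2^a∣B = proj₁ (σ5-divisibility-split a b p-prime p-odd n∣σ5)
  p^b∣A : p ^ b ∣ geom 32 (suc a)
  p^b∣A = proj₂ (σ5-divisibility-split a b p-prime p-odd n∣σ5)
  p+1≡ : suc p ≡ 2 ^ suc a
  p+1≡ = σ5-divisible⇒mersenne {a} {b} 1≤a p-prime p-odd p+1< 2^a∣B p^b∣A

backward : ∀ {a b p} → Prime p → ¬ 2 ∣ p →
  (2 ∣ 2 ^ a * p ^ b × Perfect (2 ^ a * p ^ b)) × 2 ^ a * p ^ b ≢ 496 →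
  2 ^ a * p ^ b ∣ σ 5 (2 ^ a * p ^ b)
backward {a} {b} p-prime p-odd ((_ , perfect) , n≢496) =
  mersenne-≢496⇒σ5-divisible {a} {b} p-prime p-odd (perfect⇒mersenne {a} {b} p-prime p-odd perfect) n≢496

theorem1p4 : (α β p : ℕ) → 1 < α → 1 < β → Prime p → ¬ (2 ∣ p) →
    p < 3 * 2 ^ (α ∸ 1) ∸ 1 →
    (2 ^ (α ∸ 1) * p ^ (β ∸ 1)) ∣ σ 5 (2 ^ (α ∸ 1) * p ^ (β ∸ 1))
      ⇔ ((2 ∣ (2 ^ (α ∸ 1) * p ^ (β ∸ 1)) × Perfect (2 ^ (α ∸ 1) * p ^ (β ∸ 1)))
          × (2 ^ (α ∸ 1) * p ^ (β ∸ 1)) ≢ 496)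
theorem1p4 (suc a) (suc b) p (s≤s 1≤a) (s≤s 1≤b) p-prime p-odd p<3·2^a-1 =
  mk⇔ (forward {a} {b} 1≤a 1≤b p-prime p-odd p+1<) (backward {a} {b} p-prime p-odd)
  where
  p+1< : suc p < 3 * 2 ^ a
  p+1< = shift (3 * 2 ^ a) p<3·2^a-1
    where
    shift : ∀ X → p < X ∸ 1 → suc p < X
    shift (suc X) p<X = s≤s p<X
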